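{- Let $n\geq 2$ be an integer and let $M$ be an $n$-connected binary matroid with $|E(M)|\geq 2n-2$. Suppose $T\subset E(M)$ with $|T|=n-1$. Then the element splitting matroid $M'_T$ is $n$-connected if and only if $|Q|\geq 2|Q\cap T|$ for every cocircuit $Q$ of $M$ with $Q\cap T\neq\emptyset$.
   Context: Element splitting: let $M$ be a binary matroid with standard matrix representation $A$ over $GF(2)$ and $T\subseteq E(M)$. Let $A'_T$ be the matrix obtained from $A$ by adjoining an extra row whose entries are $1$ in the columns labelled by elements of $T$ and $0$ otherwise, and then adjoining an extra column labelled by a new element $a$ with $1$ in the last row and $0$ elsewhere. $M'_T$ denotes the vector matroid of $A'_T$ (ground set $E(M)\cup\{a\}$). A matroid is $n$-connected (in Tutte's sense) if it has no $k$-separation for any $k<n$, where a $k$-separation of a matroid $N$ with rank function $r$ is a partition $(X,Y)$ of $E(N)$ with $\min\{|X|,|Y|\}\geq k$ and $r(X)+r(Y)-r(E(N))\leq k-1$. -}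

module Defs where

open import Data.Nat using (ℕ; zero; suc; _+_; _*_; _∸_; _≤_; _<_; _⊔_)
open import Data.Bool using (Bool; true; false; _∧_; _∨_; _xor_; not; if_then_else_)
open import Data.Fin using (Fin; zero; suc)
open import Data.Vec using (Vec; []; _∷_; lookup)
open import Data.List using (List; []; _∷_; _++_; map; foldr)
open import Data.Fin.Subset using (Subset; inside; outside; ∣_∣; ∁; _∩_; _∪_; ⁅_⁆; ⊤; _∈_; Nonempty)
open import Data.Product using (_×_)
open import Relation.Nullary using (¬_)
open import Relation.Binary.PropositionalEquality using (_≡_)

-- Matrices over GF(2) = Bool (addition = xor, multiplication = ∧).
-- A matrix with r rows and m columns; columns are the ground set Fin m.

Matrix : ℕ → ℕ → Set
Matrix r m = Fin r → Fin m → Bool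

allSubsets : (m : ℕ) → List (Subset m)
allSubsets zero = [] ∷ []
allSubsets (suc m) = map (outside ∷_) (allSubsets m) ++ map (inside ∷_) (allSubsets m)

sumOver : ∀ {m} → Subset m → (Fin m → Bool) → Bool
sumOver [] v = false
sumOver (s ∷ Z) v = (s ∧ v zero) xor sumOver Z (λ j → v (suc j))

isZero : ∀ {r} → (Fin r → Bool) → Bool
isZero {zero} v = true
isZero {suc r} v = not (v zero) ∧ isZero (λ i → v (suc i))

colSum : ∀ {r m} → Matrix r m → Subset m → (Fin r → Bool)
colSum A Z i = sumOver Z (A i)

subsetB : ∀ {m} → Subset m → Subset m → Bool
subsetB [] [] = true
subsetB (x ∷ X) (y ∷ Y) = (not x ∨ y) ∧ subsetB X Y

emptyB : ∀ {m} → Subset m → Bool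
emptyB [] = true
emptyB (x ∷ X) = not x ∧ emptyB X

allL : ∀ {A : Set} → (A → Bool) → List A → Bool
allL p = foldr (λ x b → p x ∧ b) true

indepB : ∀ {r m} → Matrix r m → Subset m → Bool
indepB {m = m} A X =
  allL (λ Z → not (subsetB Z X) ∨ emptyB Z ∨ not (isZero (colSum A Z))) (allSubsets m)

rank : ∀ {r m} → Matrix r m → Subset m → ℕ
rank {m = m} A X =
  foldr (λ Z k → if subsetB Z X ∧ indepB A Z then ∣ Z ∣ ⊔ k else k) 0 (allSubsets m)

IsSeparation : ∀ {r m} → Matrix r m → ℕ → Subset m → Set
IsSeparation A k X =
  k ≤ ∣ X ∣ × k ≤ ∣ ∁ X ∣ × (rank A X + rank A (∁ X) ∸ rank A ⊤ ≤ k ∸ 1)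

NConnected : ∀ {r m} → Matrix r m → ℕ → Set
NConnected {m = m} A n =
  ∀ (k : ℕ) (X : Subset m) → 1 ≤ k → k < n → ¬ IsSeparation A k X

IsHyperplane : ∀ {r m} → Matrix r m → Subset m → Set
IsHyperplane A H =
  (rank A H + 1 ≡ rank A ⊤) × (∀ e → ¬ (e ∈ H) → rank A (H ∪ ⁅ e ⁆) ≡ rank A ⊤)

IsCocircuit : ∀ {r m} → Matrix r m → Subset m → Set
IsCocircuit A Q = IsHyperplane A (∁ Q)

-- Element splitting.  The new row is row 'zero' and the new element a is
-- column 'zero'; an old element j of M corresponds to column 'suc j'.

splitMatrix : ∀ {r m} → Matrix r m → Subset m → Matrix (suc r) (suc m)
splitMatrix A T zero zero = true
splitMatrix A T zero (suc j) = lookup T j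
splitMatrix A T (suc i) zero = false
splitMatrix A T (suc i) (suc j) = A i j

module Submission where

-- M = M[A] for a GF(2)-matrix A (columns = ground set), and M'_T = M[A'] for the
-- split matrix A' = splitMatrix A T, whose new row is the indicator of T and
-- whose new column a is the unit vector of that row.  The proof is linear
-- algebra over GF(2) organised around linear functionals y : rows → GF(2).
-- The cocycle of y is the set D(y) = {e : y·A_e = 1}; every cocircuit is a
-- cocycle, and a set X has rank below r(M) exactly when some y vanishes on X
-- without vanishing on all of E.
--
-- Next come two facts about
-- cocycles of M: in an n-connected M with |E| ≥ 2n-2 every nonempty cocycle has
-- at least n elements, and under the cocircuit condition |Q| ≥ 2|Q ∩ T| every
-- cocycle D satisfies |D| ≥ 2|D ∩ T| (a cocycle is a cocircuit or splits into
-- two smaller cocycles).  After comparing the ranks of M and M'_T, the forward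
-- direction turns a bad cocircuit Q into the small separation ({a} ∪ (Q Δ T), rest)
-- of M'_T; the backward direction turns a small separation of M'_T into either a
-- separation of M or a functional whose cocycle contradicts one of the two facts.

open import Defs
open import Data.Nat using (ℕ; zero; suc; _+_; _*_; _∸_; _≤_; _<_; _≥_; _⊔_; z≤n; s≤s; _≤?_; _≟_)
open import Data.Nat.Properties
open import Data.Nat.Solver using (module +-*-Solver)
open import Algebra.Properties.CommutativeSemigroup +-commutativeSemigroup using () renaming (interchange to +-interchange)
open import Data.Bool using (Bool; true; false; _∧_; _∨_; _xor_; not; if_then_else_)
open import Data.Bool.Properties
  using (xor-comm; xor-same; xor-identityʳ; not-involutive; ¬-not; ∧-zeroʳ; ∧-identityʳ;
         ∧-conicalˡ; ∧-conicalʳ; ∨-identityʳ; ∨-zeroʳ; ∨-sel; ∧-comm; ∧-assoc; ∧-distribˡ-xor; ∧-distribʳ-xor)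
  renaming (_≟_ to _≟ᵇ_)
open import Data.Bool.Solver using (module xor-∧-Solver)
open import Data.Fin using (Fin; zero; suc)
import Data.Fin.Properties as Fin
open import Data.Vec using ([]; _∷_; lookup; tabulate; replicate)
open import Data.Vec.Functional using (tail) renaming (_∷_ to _∷ᶠ_)
open import Data.Vec.Properties using (lookup∘tabulate; []=⇒lookup; lookup⇒[]=; lookup-map; lookup-zipWith; lookup-replicate)
open import Data.List using (List; []; _∷_; foldr)
import Data.List as List
open import Data.List.Membership.Propositional using () renaming (_∈_ to _∈ₗ_)
open import Data.List.Membership.Propositional.Properties using (∈-map⁺; ∈-++⁺ˡ; ∈-++⁺ʳ)
open import Data.List.Relation.Unary.Any using (here; there)
open import Data.Fin.Subset using (Subset; inside; outside; ∣_∣; ∁; _∩_; _∪_; ⁅_⁆; ⊤; _∈_; Nonempty)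
open import Data.Fin.Subset.Properties using (∣∁p∣≡n∸∣p∣)
open import Data.Product using (_×_; _,_; proj₁; proj₂; Σ)
open import Data.Sum using (_⊎_; inj₁; inj₂)
open import Data.Empty using (⊥; ⊥-elim)
open import Function.Bundles using (_⇔_; mk⇔; Equivalence)
open import Relation.Nullary using (¬_; yes; no)
open import Relation.Nullary.Decidable using (decidable-stable; _×-dec_)
open import Relation.Binary.PropositionalEquality
  using (_≡_; _≢_; refl; sym; trans; cong; cong₂; subst; subst₂; module ≡-Reasoning)

true≢false : true ≢ false
true≢false ()

xor-interchange : ∀ a b c d → (a xor b) xor (c xor d) ≡ (a xor c) xor (b xor d)
xor-interchange = solve 4 (λ a b c d → (a :+ b) :+ (c :+ d) := (a :+ c) :+ (b :+ d)) refl
  where open xor-∧-Solver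

xor-cancelʳ : ∀ x y c → x xor c ≡ y xor c → x ≡ y
xor-cancelʳ false false c h = refl
xor-cancelʳ true true c h = refl
xor-cancelʳ false true false ()
xor-cancelʳ false true true ()
xor-cancelʳ true false false ()
xor-cancelʳ true false true ()

not≡true : ∀ {b} → not b ≡ true → b ≡ false
not≡true {false} _ = refl

δ : ∀ {m} → Fin m → Fin m → Bool
δ zero zero = true
δ zero (suc _) = false
δ (suc _) zero = false
δ (suc a) (suc b) = δ a b

δ-refl : ∀ {m} (p : Fin m) → δ p p ≡ true
δ-refl zero = refl
δ-refl (suc p) = δ-refl p

δ-true : ∀ {m} (p e : Fin m) → δ p e ≡ true → p ≡ e
δ-true zero zero _ = refl
δ-true zero (suc e) ()
δ-true (suc p) zero ()
δ-true (suc p) (suc e) h = cong suc (δ-true p e h)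

sum₂ : ∀ {m} → (Fin m → Bool) → Bool
sum₂ {zero} f = false
sum₂ {suc m} f = f zero xor sum₂ (λ e → f (suc e))

sum₂-cong : ∀ {m} {f g : Fin m → Bool} → (∀ e → f e ≡ g e) → sum₂ f ≡ sum₂ g
sum₂-cong {zero} h = refl
sum₂-cong {suc m} h = cong₂ _xor_ (h zero) (sum₂-cong (λ e → h (suc e)))

sum₂-xor : ∀ {m} (f g : Fin m → Bool) → sum₂ (λ e → f e xor g e) ≡ sum₂ f xor sum₂ g
sum₂-xor {zero} f g = refl
sum₂-xor {suc m} f g =
  trans (cong ((f zero xor g zero) xor_) (sum₂-xor (λ e → f (suc e)) (λ e → g (suc e))))
        (xor-interchange (f zero) (g zero) _ _)

sum₂-zero : ∀ {m} (f : Fin m → Bool) → (∀ e → f e ≡ false) → sum₂ f ≡ false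
sum₂-zero {zero} f h = refl
sum₂-zero {suc m} f h rewrite h zero = sum₂-zero (λ e → f (suc e)) (λ e → h (suc e))

sum₂-∧ : ∀ {m} b (f : Fin m → Bool) → b ∧ sum₂ f ≡ sum₂ (λ e → b ∧ f e)
sum₂-∧ true f = refl
sum₂-∧ false f = sym (sum₂-zero (λ e → false ∧ f e) (λ _ → refl))

sum₂-δ : ∀ {m} (p : Fin m) (h : Fin m → Bool) → sum₂ (λ e → δ p e ∧ h e) ≡ h p
sum₂-δ {suc m} zero h =
  trans (cong (h zero xor_) (sum₂-zero {m} _ (λ e → refl))) (xor-identityʳ (h zero))
sum₂-δ (suc p) h = sum₂-δ p (λ e → h (suc e))

sumOver-sum₂ : ∀ {m} (Z : Subset m) (g : Fin m → Bool) → sumOver Z g ≡ sum₂ (λ e → lookup Z e ∧ g e)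
sumOver-sum₂ [] g = refl
sumOver-sum₂ (s ∷ Z) g = cong ((s ∧ g zero) xor_) (sumOver-sum₂ Z (λ j → g (suc j)))

bit : Bool → ℕ
bit true = 1
bit false = 0

count : ∀ {m} → (Fin m → Bool) → ℕ
count {zero} f = 0
count {suc m} f = bit (f zero) + count (λ e → f (suc e))

∣∣≡count : ∀ {m} (Z : Subset m) → ∣ Z ∣ ≡ count (lookup Z)
∣∣≡count [] = refl
∣∣≡count (true ∷ Z) = cong suc (∣∣≡count Z)
∣∣≡count (false ∷ Z) = ∣∣≡count Z

count-cong : ∀ {m} {f g : Fin m → Bool} → (∀ e → f e ≡ g e) → count f ≡ count g
count-cong {zero} h = refl
count-cong {suc m} h = cong₂ _+_ (cong bit (h zero)) (count-cong (λ e → h (suc e)))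

count-mono : ∀ {m} {f g : Fin m → Bool} → (∀ e → f e ≡ true → g e ≡ true) → count f ≤ count g
count-mono {zero} h = z≤n
count-mono {suc m} {f} {g} h with f zero in ef | g zero in eg
... | true | true = s≤s (count-mono (λ e → h (suc e)))
... | true | false = ⊥-elim (true≢false (trans (sym (h zero ef)) eg))
... | false | true = ≤-trans (count-mono (λ e → h (suc e))) (n≤1+n _)
... | false | false = count-mono (λ e → h (suc e))

count-witness : ∀ {m} (f : Fin m → Bool) → 1 ≤ count f → Σ (Fin m) λ e → f e ≡ true
count-witness {zero} f ()
count-witness {suc m} f h with f zero in ef
... | true = zero , ef
... | false = let (e , p) = count-witness (λ e → f (suc e)) h in suc e , p

count-pos : ∀ {m} (f : Fin m → Bool) e → f e ≡ true → 1 ≤ count f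
count-pos f zero h rewrite h = s≤s z≤n
count-pos {suc m} f (suc e) h =
  ≤-trans (count-pos (λ e → f (suc e)) e h) (m≤n+m _ (bit (f zero)))

count-xor : ∀ {m} (f g : Fin m → Bool) →
  count (λ e → f e xor g e) + 2 * count (λ e → f e ∧ g e) ≡ count f + count g
count-xor {zero} f g = refl
count-xor {suc m} f g =
  trans (regroup (bit (f zero xor g zero)) _ (bit (f zero ∧ g zero)) _)
    (trans (cong₂ _+_ (bit-xor (f zero) (g zero)) (count-xor (λ e → f (suc e)) (λ e → g (suc e))))
      (+-interchange (bit (f zero)) (bit (g zero)) _ _))
  where
  regroup : ∀ x X y Y → (x + X) + 2 * (y + Y) ≡ (x + 2 * y) + (X + 2 * Y)
  regroup = solve 4 (λ x X y Y → (x :+ X) :+ con 2 :* (y :+ Y) := (x :+ con 2 :* y) :+ (X :+ con 2 :* Y)) refl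
    where open +-*-Solver
  bit-xor : ∀ a b → bit (a xor b) + 2 * bit (a ∧ b) ≡ bit a + bit b
  bit-xor true true = refl
  bit-xor true false = refl
  bit-xor false true = refl
  bit-xor false false = refl

count-nested : ∀ {m} (f g t : Fin m → Bool) → (∀ e → g e ≡ true → f e ≡ true) →
  count (λ e → f e ∧ t e) ≡ count (λ e → g e ∧ t e) + count (λ e → (f e xor g e) ∧ t e)
count-nested {zero} f g t h = refl
count-nested {suc m} f g t h =
  trans (cong₂ _+_ (bit-nested (f zero) (g zero) (t zero) (h zero))
                   (count-nested (tail f) (tail g) (tail t) (λ e → h (suc e))))
        (+-interchange (bit (g zero ∧ t zero)) _ _ _)
  where
  bit-nested : ∀ a b c → (b ≡ true → a ≡ true) → bit (a ∧ c) ≡ bit (b ∧ c) + bit ((a xor b) ∧ c)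
  bit-nested true true c _ = sym (+-identityʳ (bit c))
  bit-nested true false c _ = refl
  bit-nested false true c h with h refl
  ... | ()
  bit-nested false false c _ = refl

count-∧true : ∀ {m} (f : Fin m → Bool) → count (λ e → f e ∧ true) ≡ count f
count-∧true f = count-cong (λ e → ∧-identityʳ (f e))

count-insert : ∀ {m} (f : Fin m → Bool) (p : Fin m) → f p ≡ false → count (λ e → f e ∨ δ p e) ≡ suc (count f)
count-insert {suc m} f zero h rewrite h = cong suc (count-cong {m} (λ e → ∨-identityʳ (f (suc e))))
count-insert {suc m} f (suc p) h with f zero
... | true = cong suc (count-insert (λ e → f (suc e)) p h)
... | false = count-insert (λ e → f (suc e)) p h

count-delete : ∀ {m} (f : Fin m → Bool) (p : Fin m) → f p ≡ true → count f ≡ suc (count (λ e → f e ∧ not (δ p e)))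
count-delete {suc m} f zero h rewrite h = cong suc (count-cong {m} (λ e → sym (∧-identityʳ (f (suc e)))))
count-delete {suc m} f (suc p) h with f zero
... | true = cong suc (count-delete (λ e → f (suc e)) p h)
... | false = count-delete (λ e → f (suc e)) p h

-- The connectivity of (X, Y) is at most j - 1 when r(X) ≤ j and r(Y) < r(E).
connectivity≤pred : ∀ {a b c j} → a ≤ j → suc b ≤ c → a + b ∸ c ≤ j ∸ 1
connectivity≤pred {a} {b} {c} {j} aj bc =
  ≤-trans (∸-mono (+-monoˡ-≤ b aj) bc) (≤-reflexive (shift j b))
  where
  shift : ∀ j b → j + b ∸ suc b ≡ j ∸ 1
  shift j zero = cong (_∸ 1) (+-identityʳ j)
  shift j (suc b) = trans (cong (_∸ suc (suc b)) (+-suc j b)) (shift j b)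

-- The same bound when r(X) < j and r(Y) ≤ r(E).
connectivity≤pred′ : ∀ {a b c j} → suc a ≤ j → b ≤ c → a + b ∸ c ≤ j ∸ 1
connectivity≤pred′ {a} {b} {c} {j} aj bc =
  ≤-trans (∸-monoˡ-≤ c (+-monoʳ-≤ a bc)) (≤-trans (≤-reflexive (m+n∸n≡m a c)) (∸-monoˡ-≤ 1 aj))

-- A k-separation (X, Y) with k ≤ r(X) forces r(Y) < r(E).
connectivity-gap : ∀ {k a b c} → k ≤ a → 1 ≤ k → a + b ∸ c ≤ k ∸ 1 → b < c
connectivity-gap {k} {a} {b} {c} k≤a 1≤k conn with c ≤? b
... | no c≰b = ≰⇒> c≰b
... | yes c≤b = ⊥-elim (below-pred 1≤k k≤k∸1)
  where
  below-pred : ∀ {k} → 1 ≤ k → k ≤ k ∸ 1 → ⊥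
  below-pred {suc k} _ h = 1+n≰n h
  k≤k∸1 : k ≤ k ∸ 1
  k≤k∸1 = ≤-trans k≤a (≤-trans (≤-reflexive (sym (m+n∸n≡m a c))) (≤-trans (∸-monoˡ-≤ c (+-monoʳ-≤ a c≤b)) conn))

-- A set of at most p + 1 elements has a complement at least as large when |E| ≥ 2p + 2.
small≤complement : ∀ {j p m} → j ≤ suc p → p + p + 2 ≤ m → j ≤ m ∸ j
small≤complement {j} {p} {m} jp pm =
  m+n≤o⇒m≤o∸n j (≤-trans (+-mono-≤ jp jp) (≤-trans (≤-reflexive (double p)) pm))
  where
  double : ∀ p → suc p + suc p ≡ p + p + 2
  double = solve 1 (λ p → (con 1 :+ p) :+ (con 1 :+ p) := p :+ p :+ con 2) refl
    where open +-*-Solver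

-- With |T| = p + 1, a set D has |D Δ T| ≤ p exactly when |D| < 2|D ∩ T|.
small-Δ⇔unbalanced : ∀ {x c d p} → x + 2 * c ≡ d + suc p → (x ≤ p ⇔ d < 2 * c)
small-Δ⇔unbalanced {x} {c} {d} {p} eq = mk⇔
  (λ x≤p → +-cancelʳ-≤ p (suc d) (2 * c) (begin
      suc d + p    ≡⟨ sym (+-suc d p) ⟩
      d + suc p    ≡⟨ sym eq ⟩
      x + 2 * c    ≤⟨ +-monoˡ-≤ (2 * c) x≤p ⟩
      p + 2 * c    ≡⟨ +-comm p (2 * c) ⟩
      2 * c + p    ∎))
  (λ d<2c → ≤-pred (+-cancelʳ-≤ (2 * c) (suc x) (suc p) (begin
      suc x + 2 * c   ≡⟨ cong suc eq ⟩
      suc d + suc p   ≤⟨ +-monoˡ-≤ (suc p) d<2c ⟩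
      2 * c + suc p   ≡⟨ +-comm (2 * c) (suc p) ⟩
      suc p + 2 * c   ∎)))
  where open ≤-Reasoning

balance-+ : ∀ {c c₂ c₃ d d₂ d₃} → c ≡ c₂ + c₃ → d ≡ d₂ + d₃ → 2 * c₂ ≤ d₂ → 2 * c₃ ≤ d₃ → 2 * c ≤ d
balance-+ {c} {c₂} {c₃} {d} {d₂} {d₃} refl refl b₂ b₃ =
  ≤-trans (≤-reflexive (*-distribˡ-+ 2 c₂ c₃)) (+-mono-≤ b₂ b₃)

summand≤pred : ∀ {a k b N} → a ≡ k + b → 1 ≤ b → a ≤ suc N → k ≤ N
summand≤pred {k = k} refl 1≤b le = ≤-pred (≤-trans (≤-trans (≤-reflexive (+-comm 1 k)) (+-monoʳ-≤ k 1≤b)) le)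

_⊆_ : ∀ {m} → Subset m → Subset m → Set
Z ⊆ X = ∀ e → lookup Z e ≡ true → lookup X e ≡ true

Inhabited : ∀ {m} → Subset m → Set
Inhabited Z = Σ _ λ e → lookup Z e ≡ true

⊆-trans : ∀ {m} (X Y Z : Subset m) → X ⊆ Y → Y ⊆ Z → X ⊆ Z
⊆-trans X Y Z a b e h = b e (a e h)

set : ∀ {m} → (Fin m → Bool) → Subset m
set = tabulate

lookup-set : ∀ {m} (f : Fin m → Bool) e → lookup (set f) e ≡ f e
lookup-set f e = lookup∘tabulate f e

∣set∣ : ∀ {m} (f : Fin m → Bool) → ∣ set f ∣ ≡ count f
∣set∣ f = trans (∣∣≡count (tabulate f)) (count-cong (lookup∘tabulate f))

∅ : ∀ {m} → Subset m
∅ {m} = replicate m false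

lookup-∅ : ∀ {m} (e : Fin m) → lookup (∅ {m}) e ≡ false
lookup-∅ e = lookup-replicate e false

∣∅∣ : ∀ m → ∣ ∅ {m} ∣ ≡ 0
∣∅∣ zero = refl
∣∅∣ (suc m) = ∣∅∣ m

lookup-⊤ : ∀ {m} (e : Fin m) → lookup (⊤ {m}) e ≡ true
lookup-⊤ e = lookup-replicate e true

⊆-⊤ : ∀ {m} (X : Subset m) → X ⊆ ⊤
⊆-⊤ X e _ = lookup-⊤ e

lookup-⁅⁆ : ∀ {m} (e i : Fin m) → lookup ⁅ e ⁆ i ≡ δ e i
lookup-⁅⁆ zero zero = refl
lookup-⁅⁆ {suc m} zero (suc i) = lookup-replicate i false
lookup-⁅⁆ (suc e) zero = refl
lookup-⁅⁆ (suc e) (suc i) = lookup-⁅⁆ e i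

lookup-∪ : ∀ {m} (X Y : Subset m) i → lookup (X ∪ Y) i ≡ lookup X i ∨ lookup Y i
lookup-∪ X Y i = lookup-zipWith _∨_ i X Y

lookup-∩ : ∀ {m} (X Y : Subset m) i → lookup (X ∩ Y) i ≡ lookup X i ∧ lookup Y i
lookup-∩ X Y i = lookup-zipWith _∧_ i X Y

lookup-∁ : ∀ {m} (X : Subset m) i → lookup (∁ X) i ≡ not (lookup X i)
lookup-∁ X i = lookup-map i not X

∁-lookup : ∀ {m} (X : Subset m) x → lookup (∁ X) x ≡ true → lookup X x ≡ false
∁-lookup X x h = not≡true (trans (sym (lookup-∁ X x)) h)

insert remove toggle : ∀ {m} → Subset m → Fin m → Subset m
insert X f = set (λ e → lookup X e ∨ δ f e)
remove X f = set (λ e → lookup X e ∧ not (δ f e))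
toggle X f = set (λ e → lookup X e xor δ f e)

∣insert∣ : ∀ {m} (B : Subset m) f → lookup B f ≡ false → ∣ insert B f ∣ ≡ suc ∣ B ∣
∣insert∣ B f h = trans (∣set∣ (λ e → lookup B e ∨ δ f e)) (trans (count-insert (lookup B) f h) (cong suc (sym (∣∣≡count B))))

∣remove∣ : ∀ {m} (B : Subset m) f → lookup B f ≡ true → ∣ B ∣ ≡ suc ∣ remove B f ∣
∣remove∣ B f h = trans (∣∣≡count B) (trans (count-delete (lookup B) f h) (cong suc (sym (∣set∣ (λ e → lookup B e ∧ not (δ f e))))))

remove-⊆ : ∀ {m} (B : Subset m) f → remove B f ⊆ B
remove-⊆ B f e h with lookup B e in be
... | true = refl
... | false = ⊥-elim (true≢false (trans (sym h) (trans (lookup-set _ e) (cong (_∧ not (δ f e)) be))))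

toggle-⊆ : ∀ {m} (S X : Subset m) p → S ⊆ X → lookup X p ≡ true → toggle S p ⊆ X
toggle-⊆ S X p sX xp e h with lookup S e in se | δ p e in de
... | true | _ = sX e se
... | false | true with δ-true p e de
...   | refl = xp
toggle-⊆ S X p sX xp e h | false | false =
  ⊥-elim (true≢false (trans (sym h) (trans (lookup-set _ e) (cong₂ _xor_ se de))))

∣∣-mono : ∀ {m} (X W : Subset m) → X ⊆ W → ∣ X ∣ ≤ ∣ W ∣
∣∣-mono X W s = subst₂ _≤_ (sym (∣∣≡count X)) (sym (∣∣≡count W)) (count-mono s)

allSubsets-complete : ∀ {m} (Z : Subset m) → Z ∈ₗ allSubsets m
allSubsets-complete [] = here refl
allSubsets-complete {suc m} (true ∷ Z) =
  ∈-++⁺ʳ (List.map (outside ∷_) (allSubsets m)) (∈-map⁺ (inside ∷_) (allSubsets-complete Z))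
allSubsets-complete {suc m} (false ∷ Z) = ∈-++⁺ˡ (∈-map⁺ (outside ∷_) (allSubsets-complete Z))

allL-sound : ∀ {A : Set} (p : A → Bool) (xs : List A) → allL p xs ≡ true → ∀ {x} → x ∈ₗ xs → p x ≡ true
allL-sound p (y ∷ ys) h (here refl) = ∧-conicalˡ (p y) _ h
allL-sound p (y ∷ ys) h (there i) = allL-sound p ys (∧-conicalʳ (p y) _ h) i

allL-complete : ∀ {A : Set} (p : A → Bool) (xs : List A) → (∀ {x} → x ∈ₗ xs → p x ≡ true) → allL p xs ≡ true
allL-complete p [] h = refl
allL-complete p (y ∷ ys) h rewrite h (here refl) = allL-complete p ys (λ i → h (there i))

subsetB-sound : ∀ {m} (Z X : Subset m) → subsetB Z X ≡ true → Z ⊆ X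
subsetB-sound (true ∷ Z) (true ∷ X) h zero _ = refl
subsetB-sound (true ∷ Z) (false ∷ X) () e
subsetB-sound (false ∷ Z) (x ∷ X) h zero ()
subsetB-sound (true ∷ Z) (true ∷ X) h (suc e) z = subsetB-sound Z X h e z
subsetB-sound (false ∷ Z) (x ∷ X) h (suc e) z = subsetB-sound Z X h e z

subsetB-complete : ∀ {m} (Z X : Subset m) → Z ⊆ X → subsetB Z X ≡ true
subsetB-complete [] [] h = refl
subsetB-complete (true ∷ Z) (x ∷ X) h with h zero refl
... | refl = subsetB-complete Z X (λ e → h (suc e))
subsetB-complete (false ∷ Z) (x ∷ X) h = subsetB-complete Z X (λ e → h (suc e))

emptyB-sound : ∀ {m} (Z : Subset m) → emptyB Z ≡ false → Inhabited Z
emptyB-sound (true ∷ Z) h = zero , refl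
emptyB-sound (false ∷ Z) h = let (e , p) = emptyB-sound Z h in suc e , p

emptyB-complete : ∀ {m} (Z : Subset m) → Inhabited Z → emptyB Z ≡ false
emptyB-complete (true ∷ Z) _ = refl
emptyB-complete (false ∷ Z) (suc e , p) = emptyB-complete Z (e , p)

isZero-sound : ∀ {r} (v : Fin r → Bool) → isZero v ≡ true → ∀ i → v i ≡ false
isZero-sound {suc r} v h zero = not≡true (∧-conicalˡ _ _ h)
isZero-sound {suc r} v h (suc i) = isZero-sound (λ j → v (suc j)) (∧-conicalʳ _ _ h) i

isZero-complete : ∀ {r} (v : Fin r → Bool) → (∀ i → v i ≡ false) → isZero v ≡ true
isZero-complete {zero} v h = refl
isZero-complete {suc r} v h rewrite h zero = isZero-complete (λ j → v (suc j)) (λ i → h (suc i))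

Zero : ∀ {r m} → Matrix r m → Subset m → Set
Zero A Z = ∀ i → colSum A Z i ≡ false

Indep : ∀ {r m} → Matrix r m → Subset m → Set
Indep A X = ∀ Z → Z ⊆ X → Inhabited Z → ¬ Zero A Z

Indep-⊆ : ∀ {r m} (A : Matrix r m) X Y → X ⊆ Y → Indep A Y → Indep A X
Indep-⊆ A X Y s i Z sz = i Z (⊆-trans Z X Y sz s)

indepB-sound : ∀ {r m} (A : Matrix r m) X → indepB A X ≡ true → Indep A X
indepB-sound {m = m} A X h Z s ne z =
  true≢false (trans (sym (allL-sound _ (allSubsets m) h (allSubsets-complete Z))) refuted)
  where
  refuted : (not (subsetB Z X) ∨ emptyB Z ∨ not (isZero (colSum A Z))) ≡ false
  refuted rewrite subsetB-complete Z X s | emptyB-complete Z ne | isZero-complete (colSum A Z) z = refl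

indepB-complete : ∀ {r m} (A : Matrix r m) X → Indep A X → indepB A X ≡ true
indepB-complete {m = m} A X ind = allL-complete _ (allSubsets m) (λ {Z} _ → holds Z)
  where
  holds : ∀ Z → (not (subsetB Z X) ∨ emptyB Z ∨ not (isZero (colSum A Z))) ≡ true
  holds Z with subsetB Z X in e1 | emptyB Z in e2 | isZero (colSum A Z) in e3
  ... | false | _ | _ = refl
  ... | true | true | _ = refl
  ... | true | false | false = refl
  ... | true | false | true =
    ⊥-elim (ind Z (subsetB-sound Z X e1) (emptyB-sound Z e2) (isZero-sound _ e3))

module MaxFold {m : ℕ} (c : Subset m → Bool) where
  step : Subset m → ℕ → ℕ
  step Z k = if c Z then ∣ Z ∣ ⊔ k else k

  upper : ∀ (xs : List (Subset m)) {Z} → Z ∈ₗ xs → c Z ≡ true → ∣ Z ∣ ≤ foldr step 0 xs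
  upper (y ∷ ys) (here refl) h rewrite h = m≤m⊔n _ _
  upper (y ∷ ys) (there i) h with c y
  ... | true = ≤-trans (upper ys i h) (m≤n⊔m ∣ y ∣ _)
  ... | false = upper ys i h

  attained : ∀ (xs : List (Subset m)) →
    foldr step 0 xs ≡ 0 ⊎ Σ _ λ Z → c Z ≡ true × ∣ Z ∣ ≡ foldr step 0 xs
  attained [] = inj₁ refl
  attained (y ∷ ys) with c y in cy
  ... | false = attained ys
  ... | true with ⊔-sel ∣ y ∣ (foldr step 0 ys)
  ...   | inj₁ eq = inj₂ (y , cy , sym eq)
  ...   | inj₂ eq with attained ys
  ...     | inj₁ z = inj₁ (trans eq z)
  ...     | inj₂ (Z , cz , sz) = inj₂ (Z , cz , trans sz (sym eq))

rank-≥ : ∀ {r m} (A : Matrix r m) X Z → Z ⊆ X → Indep A Z → ∣ Z ∣ ≤ rank A X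
rank-≥ {m = m} A X Z s i =
  MaxFold.upper (λ Z → subsetB Z X ∧ indepB A Z) (allSubsets m) (allSubsets-complete Z)
    (cong₂ _∧_ (subsetB-complete Z X s) (indepB-complete A Z i))

record Basis {r m} (A : Matrix r m) (X : Subset m) : Set where
  constructor basis
  field
    members : Subset m
    included : members ⊆ X
    indep : Indep A members
    size : ∣ members ∣ ≡ rank A X

basisOf : ∀ {r m} (A : Matrix r m) X → Basis A X
basisOf {m = m} A X with MaxFold.attained (λ Z → subsetB Z X ∧ indepB A Z) (allSubsets m)
... | inj₁ z = basis ∅ (λ e h → ⊥-elim (true≢false (trans (sym h) (lookup-∅ e))))
      (λ Z s (e , ze) _ → true≢false (trans (sym (s e ze)) (lookup-∅ e)))
      (trans (∣∅∣ m) (sym z))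
... | inj₂ (Z , cz , sz) =
      basis Z (subsetB-sound Z X (∧-conicalˡ _ _ cz)) (indepB-sound A Z (∧-conicalʳ _ _ cz)) sz

rank-mono : ∀ {r m} (A : Matrix r m) X W → X ⊆ W → rank A X ≤ rank A W
rank-mono A X W s = let basis B bs bi bz = basisOf A X in
  subst (_≤ rank A W) bz (rank-≥ A W B (⊆-trans B X W bs s) bi)

rank≤∣∣ : ∀ {r m} (A : Matrix r m) X → rank A X ≤ ∣ X ∣
rank≤∣∣ A X = let basis B bs bi bz = basisOf A X in subst (_≤ ∣ X ∣) bz (∣∣-mono B X bs)

rank-∪⁅⁆ : ∀ {r m} (A : Matrix r m) X e → rank A (X ∪ ⁅ e ⁆) ≤ suc (rank A X)
rank-∪⁅⁆ A X e with basisOf A (X ∪ ⁅ e ⁆)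
... | basis B bs bi bz = subst (_≤ suc (rank A X)) bz (≤-trans size-B (s≤s (rank-≥ A X (remove B e) B-e⊆X B-e-indep)))
  where
  B-e-indep : Indep A (remove B e)
  B-e-indep = Indep-⊆ A (remove B e) B (remove-⊆ B e) bi
  B-e⊆X : remove B e ⊆ X
  B-e⊆X x h with lookup X x in xx | δ e x in de
  ... | true | _ = refl
  ... | false | true = ⊥-elim (true≢false (trans (sym h)
          (trans (lookup-set _ x) (trans (cong (λ d → lookup B x ∧ not d) de) (∧-zeroʳ (lookup B x))))))
  ... | false | false = ⊥-elim (true≢false (trans (sym (bs x (remove-⊆ B e x h)))
          (trans (lookup-∪ X ⁅ e ⁆ x) (cong₂ _∨_ xx (trans (lookup-⁅⁆ e x) de)))))
  size-B : ∣ B ∣ ≤ suc ∣ remove B e ∣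
  size-B with lookup B e in be
  ... | true = ≤-reflexive (∣remove∣ B e be)
  ... | false = ≤-trans (∣∣-mono B (remove B e) B⊆B-e) (n≤1+n _)
    where
    B⊆B-e : B ⊆ remove B e
    B⊆B-e x h with δ e x in de
    ... | true with δ-true e x de
    ...   | refl = ⊥-elim (true≢false (trans (sym h) be))
    B⊆B-e x h | false = trans (lookup-set _ x) (cong₂ (λ a d → a ∧ not d) h de)

col : ∀ {r m} → Matrix r m → Fin m → Fin r → Bool
col A e i = A i e

dot : ∀ {r} → (Fin r → Bool) → (Fin r → Bool) → Bool
dot {zero} y v = false
dot {suc r} y v = (y zero ∧ v zero) xor dot (λ i → y (suc i)) (λ i → v (suc i))

dot-congʳ : ∀ {r} (y : Fin r → Bool) {u v} → (∀ i → u i ≡ v i) → dot y u ≡ dot y v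
dot-congʳ {zero} y h = refl
dot-congʳ {suc r} y h =
  cong₂ _xor_ (cong (y zero ∧_) (h zero)) (dot-congʳ (λ i → y (suc i)) (λ i → h (suc i)))

dot-zeroʳ : ∀ {r} (y : Fin r → Bool) → dot y (λ _ → false) ≡ false
dot-zeroʳ {zero} y = refl
dot-zeroʳ {suc r} y rewrite ∧-zeroʳ (y zero) = dot-zeroʳ (λ i → y (suc i))

dot-zeroˡ : ∀ {r} (v : Fin r → Bool) → dot (λ _ → false) v ≡ false
dot-zeroˡ {zero} v = refl
dot-zeroˡ {suc r} v = dot-zeroˡ (λ i → v (suc i))

dot-xorʳ : ∀ {r} (y u w : Fin r → Bool) → dot y (λ i → u i xor w i) ≡ dot y u xor dot y w
dot-xorʳ {zero} y u w = refl
dot-xorʳ {suc r} y u w =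
  trans (cong₂ _xor_ (∧-distribˡ-xor (y zero) (u zero) (w zero))
                     (dot-xorʳ (λ i → y (suc i)) (λ i → u (suc i)) (λ i → w (suc i))))
        (xor-interchange (y zero ∧ u zero) (y zero ∧ w zero) _ _)

dot-xorˡ : ∀ {r} (y z v : Fin r → Bool) → dot (λ i → y i xor z i) v ≡ dot y v xor dot z v
dot-xorˡ {zero} y z v = refl
dot-xorˡ {suc r} y z v =
  trans (cong₂ _xor_ (∧-distribʳ-xor (v zero) (y zero) (z zero))
                     (dot-xorˡ (λ i → y (suc i)) (λ i → z (suc i)) (λ i → v (suc i))))
        (xor-interchange (y zero ∧ v zero) (z zero ∧ v zero) _ _)

dot-∧ʳ : ∀ {r} (y : Fin r → Bool) b (u : Fin r → Bool) → dot y (λ i → b ∧ u i) ≡ b ∧ dot y u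
dot-∧ʳ y true u = refl
dot-∧ʳ y false u = dot-zeroʳ y

dot-colSum : ∀ {r m} (A : Matrix r m) (y : Fin r → Bool) (Z : Subset m) →
  dot y (colSum A Z) ≡ sumOver Z (λ e → dot y (col A e))
dot-colSum {zero} A y Z = sym (trans (sumOver-sum₂ Z _) (sum₂-zero _ (λ e → ∧-zeroʳ (lookup Z e))))
dot-colSum {suc r} {m} A y Z =
  begin
    (y zero ∧ sumOver Z (A zero)) xor dot (λ i → y (suc i)) (λ i → sumOver Z (A (suc i)))
  ≡⟨ cong₂ _xor_ (cong (y zero ∧_) (sumOver-sum₂ Z (A zero)))
       (trans (dot-colSum (λ i e → A (suc i) e) (λ i → y (suc i)) Z) (sumOver-sum₂ Z _)) ⟩
    (y zero ∧ sum₂ (λ e → lookup Z e ∧ A zero e)) xor sum₂ (λ e → lookup Z e ∧ rest e)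
  ≡⟨ cong (_xor sum₂ (λ e → lookup Z e ∧ rest e)) (sum₂-∧ (y zero) (λ e → lookup Z e ∧ A zero e)) ⟩
    sum₂ (λ e → y zero ∧ (lookup Z e ∧ A zero e)) xor sum₂ (λ e → lookup Z e ∧ rest e)
  ≡⟨ sym (sum₂-xor (λ e → y zero ∧ (lookup Z e ∧ A zero e)) (λ e → lookup Z e ∧ rest e)) ⟩
    sum₂ (λ e → (y zero ∧ (lookup Z e ∧ A zero e)) xor (lookup Z e ∧ rest e))
  ≡⟨ sum₂-cong (λ e → factor (y zero) (lookup Z e) (A zero e) (rest e)) ⟩
    sum₂ (λ e → lookup Z e ∧ ((y zero ∧ A zero e) xor rest e))
  ≡⟨ sym (sumOver-sum₂ Z (λ e → dot y (col A e))) ⟩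
    sumOver Z (λ e → dot y (col A e)) ∎
  where
  open ≡-Reasoning
  rest : Fin m → Bool
  rest e = dot (λ i → y (suc i)) (λ i → A (suc i) e)
  factor : ∀ a z b d → (a ∧ (z ∧ b)) xor (z ∧ d) ≡ z ∧ ((a ∧ b) xor d)
  factor = solve 4 (λ a z b d → (a :* (z :* b)) :+ (z :* d) := z :* ((a :* b) :+ d)) refl
    where open xor-∧-Solver

sumOver-xor : ∀ {m} (S : Subset m) f g → sumOver S (λ e → f e xor g e) ≡ sumOver S f xor sumOver S g
sumOver-xor S f g =
  trans (sumOver-sum₂ S _)
    (trans (sum₂-cong (λ e → ∧-distribˡ-xor (lookup S e) (f e) (g e)))
      (trans (sum₂-xor (λ e → lookup S e ∧ f e) (λ e → lookup S e ∧ g e))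
        (sym (cong₂ _xor_ (sumOver-sum₂ S f) (sumOver-sum₂ S g)))))

sumOver-∧ʳ : ∀ {m} (S : Subset m) f b → sumOver S (λ e → f e ∧ b) ≡ sumOver S f ∧ b
sumOver-∧ʳ S f b =
  trans (sumOver-sum₂ S _)
    (trans (sum₂-cong (λ e → reassoc (lookup S e) (f e) b))
      (trans (sym (sum₂-∧ b (λ e → lookup S e ∧ f e)))
        (trans (cong (b ∧_) (sym (sumOver-sum₂ S f))) (∧-comm b _))))
  where
  reassoc : ∀ s a b → s ∧ (a ∧ b) ≡ b ∧ (s ∧ a)
  reassoc = solve 3 (λ s a b → s :* (a :* b) := b :* (s :* a)) refl
    where open xor-∧-Solver

sumOver-toggle : ∀ {m} (S : Subset m) p g → sumOver (toggle S p) g ≡ sumOver S g xor g p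
sumOver-toggle S p g =
  trans (sumOver-sum₂ (toggle S p) g)
    (trans (sum₂-cong (λ e → trans (cong (_∧ g e) (lookup-set _ e)) (∧-distribʳ-xor (g e) (lookup S e) (δ p e))))
      (trans (sum₂-xor (λ e → lookup S e ∧ g e) (λ e → δ p e ∧ g e))
        (cong₂ _xor_ (sym (sumOver-sum₂ S g)) (sum₂-δ p g))))

sumOver-vanishing : ∀ {m} (S : Subset m) g → (∀ e → lookup S e ≡ true → g e ≡ false) → sumOver S g ≡ false
sumOver-vanishing S g h = trans (sumOver-sum₂ S g) (sum₂-zero _ masked)
  where
  masked : ∀ e → lookup S e ∧ g e ≡ false
  masked e with lookup S e in se
  ... | false = refl
  ... | true = h e se

Vanishes : ∀ {r m} → Matrix r m → (Fin r → Bool) → Subset m → Set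
Vanishes A y X = ∀ e → lookup X e ≡ true → dot y (col A e) ≡ false

-- v lies in the span of the columns indexed by B, stated dually: every
-- functional vanishing on B vanishes on v.
InSpan : ∀ {r m} → Matrix r m → Subset m → (Fin r → Bool) → Set
InSpan A B v = ∀ y → Vanishes A y B → dot y v ≡ false

outside-kernel : ∀ {r m} (A : Matrix r m) y B f → Vanishes A y B → dot y (col A f) ≡ true → lookup B f ≡ false
outside-kernel A y B f o d with lookup B f in eq
... | true = ⊥-elim (true≢false (trans (sym d) (o f eq)))
... | false = refl

indep-insert : ∀ {r m} (A : Matrix r m) y B f → Indep A B → Vanishes A y B → dot y (col A f) ≡ true →
  Indep A (insert B f)
indep-insert A y B f ind o d Z s ne z with lookup Z f in zf
... | true = true≢false (trans (sym sum-true) sum-false)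
  where
  sum-false : sumOver Z (λ e → dot y (col A e)) ≡ false
  sum-false = trans (sym (dot-colSum A y Z)) (trans (dot-congʳ y z) (dot-zeroʳ y))
  only-f : ∀ e → (lookup Z e ∧ dot y (col A e)) ≡ (δ f e ∧ true)
  only-f e with δ f e in de
  ... | true with δ-true f e de
  ...   | refl rewrite zf | d = refl
  only-f e | false with lookup Z e in ze
  ...   | false = refl
  ...   | true with ∨-sel (lookup B e) (δ f e)
  ...     | inj₁ be = o e (trans (sym be) (trans (sym (lookup-set _ e)) (s e ze)))
  ...     | inj₂ fe = ⊥-elim (true≢false (trans (trans (sym (s e ze)) (lookup-set _ e)) (trans fe de)))
  sum-true : sumOver Z (λ e → dot y (col A e)) ≡ true
  sum-true = trans (sumOver-sum₂ Z _) (trans (sum₂-cong only-f) (sum₂-δ f (λ _ → true)))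
... | false = ind Z Z⊆B ne z
  where
  Z⊆B : Z ⊆ B
  Z⊆B e ze with lookup B e in be | δ f e in de
  ... | true | _ = refl
  ... | false | false = trans (sym (trans (lookup-set _ e) (cong₂ _∨_ be de))) (s e ze)
  ... | false | true with δ-true f e de
  ...   | refl = ⊥-elim (true≢false (trans (sym ze) zf))

insert-rank : ∀ {r m} (A : Matrix r m) y B f W → Indep A B → Vanishes A y B → dot y (col A f) ≡ true →
  insert B f ⊆ W → suc ∣ B ∣ ≤ rank A W
insert-rank A y B f W ind o d s = subst (_≤ rank A W) (∣insert∣ B f (outside-kernel A y B f o d))
  (rank-≥ A W (insert B f) s (indep-insert A y B f ind o d))

rank-gap : ∀ {r m} (A : Matrix r m) y X f → Vanishes A y X → dot y (col A f) ≡ true →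
  suc (rank A X) ≤ rank A ⊤
rank-gap A y X f o d = let basis B bs bi bz = basisOf A X in
  subst (λ k → suc k ≤ rank A ⊤) bz
    (insert-rank A y B f ⊤ bi (λ e be → o e (bs e be)) d (⊆-⊤ (insert B f)))

-- A basis of X spans every column of X (otherwise it could be enlarged inside X).
basis-spans : ∀ {r m} (A : Matrix r m) X (b : Basis A X) x → lookup X x ≡ true →
  InSpan A (Basis.members b) (col A x)
basis-spans A X (basis B bs bi bz) x xx y o with dot y (col A x) in d
... | false = refl
... | true = ⊥-elim (<-irrefl bz (insert-rank A y B x X bi o d B+x⊆X))
  where
  B+x⊆X : insert B x ⊆ X
  B+x⊆X e h with ∨-sel (lookup B e) (δ x e)
  ... | inj₁ be = bs e (trans (sym be) (trans (sym (lookup-set _ e)) h))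
  ... | inj₂ de with δ-true x e (trans (sym de) (trans (sym (lookup-set _ e)) h))
  ...   | refl = xx

-- Gaussian elimination: a vector in the span of X is a sum of columns of X.

SumOf : ∀ {r m} → Matrix r m → Subset m → (Fin r → Bool) → Set
SumOf {m = m} A X v = Σ (Subset m) λ S → S ⊆ X × (∀ i → colSum A S i ≡ v i)

-- Clearing row 0 of w using a pivot column c with c zero = true.
eliminate : ∀ {r} → (Fin (suc r) → Bool) → (Fin (suc r) → Bool) → Fin r → Bool
eliminate c w i = w (suc i) xor (w zero ∧ c (suc i))

reduceBy : ∀ {r m} → Matrix (suc r) m → Fin m → Matrix r m
reduceBy A p i e = eliminate (col A p) (col A e) i

dot-eliminate : ∀ {r} (c w : Fin (suc r) → Bool) (y : Fin r → Bool) →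
  dot (dot y (tail c) ∷ᶠ y) w ≡ dot y (eliminate c w)
dot-eliminate c w y =
  trans (reorder (dot y (tail c)) (w zero) (dot y (tail w)))
    (sym (trans (dot-xorʳ y (tail w) (λ i → w zero ∧ c (suc i)))
      (cong (dot y (tail w) xor_) (dot-∧ʳ y (w zero) (tail c)))))
  where
  reorder : ∀ a b d → (a ∧ b) xor d ≡ d xor (b ∧ a)
  reorder = solve 3 (λ a b d → (a :* b) :+ d := d :+ (b :* a)) refl
    where open xor-∧-Solver

colSum-reduceBy : ∀ {r m} (A : Matrix (suc r) m) p S i →
  colSum (reduceBy A p) S i ≡ eliminate (col A p) (colSum A S) i
colSum-reduceBy A p S i =
  trans (sumOver-xor S (A (suc i)) (λ e → A zero e ∧ A (suc i) p))
    (cong (colSum A S (suc i) xor_) (sumOver-∧ʳ S (A zero) (A (suc i) p)))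

eliminate-injective : ∀ {r} (c u w : Fin (suc r) → Bool) → u zero ≡ w zero →
  (∀ i → eliminate c u i ≡ eliminate c w i) → ∀ i → u i ≡ w i
eliminate-injective c u w h0 h zero = h0
eliminate-injective c u w h0 h (suc i) =
  xor-cancelʳ _ _ (u zero ∧ c (suc i)) (trans (h i) (cong (λ t → w (suc i) xor (t ∧ c (suc i))) (sym h0)))

eliminate-pivot : ∀ {r} (c u : Fin (suc r) → Bool) → c zero ≡ true →
  ∀ i → eliminate c (λ j → u j xor c j) i ≡ eliminate c u i
eliminate-pivot c u c0 i rewrite c0 = absorb (u (suc i)) (c (suc i)) (u zero)
  where
  absorb : ∀ a b d → (a xor b) xor ((d xor true) ∧ b) ≡ a xor (d ∧ b)
  absorb = solve 3 (λ a b d → (a :+ b) :+ ((d :+ con true) :* b) := a :+ (d :* b)) refl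
    where open xor-∧-Solver

pivot-inSpan : ∀ {r m} (A : Matrix (suc r) m) X v p → InSpan A X v →
  InSpan (reduceBy A p) X (eliminate (col A p) v)
pivot-inSpan A X v p span y o =
  trans (sym (dot-eliminate (col A p) v y))
    (span (dot y (tail (col A p)) ∷ᶠ y) (λ e xe → trans (dot-eliminate (col A p) (col A e) y) (o e xe)))

pivot-lift : ∀ {r m} (A : Matrix (suc r) m) X v p → lookup X p ≡ true → A zero p ≡ true →
  SumOf (reduceBy A p) X (eliminate (col A p) v) → SumOf A X v
pivot-lift A X v p xp ap (S , S⊆X , sol) with colSum A S zero ≟ᵇ v zero
... | yes same = S , S⊆X , eliminate-injective (col A p) _ v same reduced
  where
  reduced : ∀ i → eliminate (col A p) (colSum A S) i ≡ eliminate (col A p) v i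
  reduced i = trans (sym (colSum-reduceBy A p S i)) (sol i)
... | no differ = toggle S p , toggle-⊆ S X p S⊆X xp ,
      eliminate-injective (col A p) _ v row0 reduced
  where
  sum-toggled : ∀ i → colSum A (toggle S p) i ≡ colSum A S i xor A i p
  sum-toggled i = sumOver-toggle S p (A i)
  row0 : colSum A (toggle S p) zero ≡ v zero
  row0 = trans (sum-toggled zero) (trans (cong (colSum A S zero xor_) ap)
           (trans (xor-comm _ true) (sym (¬-not (λ eq → differ (sym eq))))))
  reduced : ∀ i → eliminate (col A p) (colSum A (toggle S p)) i ≡ eliminate (col A p) v i
  reduced i =
    trans (cong₂ (λ a b → a xor (b ∧ A (suc i) p)) (sum-toggled (suc i)) (sum-toggled zero))
      (trans (eliminate-pivot (col A p) (colSum A S) ap i)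
        (trans (sym (colSum-reduceBy A p S i)) (sol i)))

-- Zero-row case: row 0 vanishes on X, so it vanishes on v and can be dropped.
zeroRow-inSpan : ∀ {r m} (A : Matrix (suc r) m) X v → InSpan A X v →
  InSpan (λ i → A (suc i)) X (tail v)
zeroRow-inSpan A X v span y o = span (false ∷ᶠ y) o

zeroRow-lift : ∀ {r m} (A : Matrix (suc r) m) X v → InSpan A X v →
  (∀ e → lookup X e ≡ true → A zero e ≡ false) →
  SumOf (λ i → A (suc i)) X (tail v) → SumOf A X v
zeroRow-lift A X v span row0 (S , S⊆X , sol) = S , S⊆X , solution
  where
  unit : Fin _ → Bool
  unit = true ∷ᶠ (λ _ → false)
  dot-unit : ∀ w → dot unit w ≡ w zero
  dot-unit w = trans (cong (w zero xor_) (dot-zeroˡ (tail w))) (xor-identityʳ (w zero))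
  v0 : v zero ≡ false
  v0 = trans (sym (dot-unit v)) (span unit (λ e xe → trans (dot-unit (col A e)) (row0 e xe)))
  solution : ∀ i → colSum A S i ≡ v i
  solution zero = trans (sumOver-vanishing S (A zero) (λ e se → row0 e (S⊆X e se))) (sym v0)
  solution (suc i) = sol i

inSpan⇒SumOf : ∀ {r m} (A : Matrix r m) X v → InSpan A X v → SumOf A X v
inSpan⇒SumOf {zero} A X v span = ∅ , (λ e h → ⊥-elim (true≢false (trans (sym h) (lookup-∅ e)))) , (λ ())
inSpan⇒SumOf {suc r} A X v span with Fin.any? (λ e → (lookup X e ≟ᵇ true) ×-dec (A zero e ≟ᵇ true))
... | yes (p , xp , ap) =
  pivot-lift A X v p xp ap
    (inSpan⇒SumOf (reduceBy A p) X (eliminate (col A p) v) (pivot-inSpan A X v p span))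
... | no noPivot =
  zeroRow-lift A X v span row0
    (inSpan⇒SumOf (λ i → A (suc i)) X (tail v) (zeroRow-inSpan A X v span))
  where
  row0 : ∀ e → lookup X e ≡ true → A zero e ≡ false
  row0 e xe with A zero e in ae
  ... | false = refl
  ... | true = ⊥-elim (noPivot (e , xe , ae))

SpansAll : ∀ {r m} → Matrix r m → Subset m → Subset m → Set
SpansAll A B Z = ∀ z → lookup Z z ≡ true → InSpan A B (col A z)

-- An independent Z whose columns are spanned by a subset B ⊆ Z is contained in B:
-- a column z ∈ Z ∖ B would be a sum of columns of B, a dependency inside Z.
spanned-independent⇒⊆ : ∀ {r m} (A : Matrix r m) B Z → B ⊆ Z → Indep A Z → SpansAll A B Z → Z ⊆ B
spanned-independent⇒⊆ A B Z B⊆Z iZ spans z zz with lookup B z in bz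
... | true = refl
... | false with inSpan⇒SumOf A B (col A z) (spans z zz)
...   | S , S⊆B , sumS = ⊥-elim (iZ W W⊆Z (z , z∈W) W-sums-to-zero)
  where
  W = toggle S z
  W⊆Z : W ⊆ Z
  W⊆Z = toggle-⊆ S Z z (⊆-trans S B Z S⊆B B⊆Z) zz
  z∉S : lookup S z ≡ false
  z∉S with lookup S z in e
  ... | true = ⊥-elim (true≢false (trans (sym (S⊆B z e)) bz))
  ... | false = refl
  z∈W : lookup W z ≡ true
  z∈W = trans (lookup-set _ z) (cong₂ _xor_ z∉S (δ-refl z))
  W-sums-to-zero : Zero A W
  W-sums-to-zero i = trans (sumOver-toggle S z (A i)) (trans (cong (_xor A i z) (sumS i)) (xor-same (A i z)))

-- |B ∖ Z|, the measure for the induction in the exchange lemma.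
∣_∖_∣ : ∀ {m} → Subset m → Subset m → ℕ
∣ B ∖ Z ∣ = count (λ e → lookup B e ∧ not (lookup Z e))

-- Swapping b ∈ B ∖ Z for a column z ∈ Z outside the span of B - b: the new set
-- B' = (B - b) + z is independent, as large as B, closer to Z, and still spans Z.
record Swap {r m} (A : Matrix r m) (B Z : Subset m) (b : Fin m) : Set where
  field
    B′ : Subset m
    indep : Indep A B′
    size : ∣ B′ ∣ ≡ ∣ B ∣
    closer : ∣ B′ ∖ Z ∣ ≤ ∣ remove B b ∖ Z ∣
    spans : SpansAll A B′ Z

swap : ∀ {r m} (A : Matrix r m) B Z b z y₀ → Indep A B → SpansAll A B Z →
  lookup B b ≡ true → lookup Z z ≡ true →
  Vanishes A y₀ (remove B b) → dot y₀ (col A z) ≡ true → Swap A B Z b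
swap A B Z b z y₀ iB spans bb zz o₀ d₀ = record
  { B′ = B′ ; indep = indep-insert A y₀ B₀ z (Indep-⊆ A B₀ B (remove-⊆ B b) iB) o₀ d₀
  ; size = trans (∣insert∣ B₀ z (outside-kernel A y₀ B₀ z o₀ d₀)) (sym (∣remove∣ B b bb))
  ; closer = count-mono closer ; spans = λ z′ zz′ y o → spans z′ zz′ y (vanishes-B y o) }
  where
  B₀ = remove B b
  B′ = insert B₀ z
  B₀⊆B′ : ∀ e → lookup B₀ e ≡ true → lookup B′ e ≡ true
  B₀⊆B′ e h = trans (lookup-set _ e) (cong (_∨ δ z e) h)
  z∈B′ : lookup B′ z ≡ true
  z∈B′ = trans (lookup-set _ z) (trans (cong (lookup B₀ z ∨_) (δ-refl z)) (∨-zeroʳ (lookup B₀ z)))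
  extend : ∀ y → Vanishes A y B₀ → dot y (col A b) ≡ false → Vanishes A y B
  extend y o yb e be with δ b e in de
  ... | true with δ-true b e de
  ...   | refl = yb
  extend y o yb e be | false = o e (trans (lookup-set _ e) (cong₂ (λ x d → x ∧ not d) be de))
  y₀b : dot y₀ (col A b) ≡ true
  y₀b with dot y₀ (col A b) in e
  ... | true = refl
  ... | false = ⊥-elim (true≢false (trans (sym d₀) (spans z zz y₀ (extend y₀ o₀ e))))
  -- y vanishing on B′ also vanishes on b: otherwise y ⊕ y₀ vanishes on B but not on z
  vanishes-B : ∀ y → Vanishes A y B′ → Vanishes A y B
  vanishes-B y o = extend y oB₀ yb
    where
    oB₀ : Vanishes A y B₀
    oB₀ e h = o e (B₀⊆B′ e h)
    yb : dot y (col A b) ≡ false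
    yb with dot y (col A b) in e
    ... | false = refl
    ... | true = ⊥-elim (true≢false (trans (sym sum-on-z) (spans z zz (λ i → y i xor y₀ i) sum-vanishes)))
      where
      sum-vanishes : Vanishes A (λ i → y i xor y₀ i) B
      sum-vanishes = extend _ (λ e h → trans (dot-xorˡ y y₀ (col A e)) (cong₂ _xor_ (oB₀ e h) (o₀ e h)))
                       (trans (dot-xorˡ y y₀ (col A b)) (cong₂ _xor_ e y₀b))
      sum-on-z : dot (λ i → y i xor y₀ i) (col A z) ≡ true
      sum-on-z = trans (dot-xorˡ y y₀ (col A z)) (cong₂ _xor_ (o z z∈B′) d₀)
  closer : ∀ e → lookup B′ e ∧ not (lookup Z e) ≡ true → lookup B₀ e ∧ not (lookup Z e) ≡ true
  closer e h with lookup Z e in ze | lookup B₀ e in b₀e | δ z e in de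
  ... | true | _ | _ = ⊥-elim (true≢false (trans (sym h) (∧-zeroʳ (lookup B′ e))))
  ... | false | true | _ = refl
  ... | false | false | true with δ-true z e de
  ...   | refl = ⊥-elim (true≢false (trans (sym zz) ze))
  closer e h | false | false | false =
    ⊥-elim (true≢false (trans (sym h) (cong (_∧ true) (trans (lookup-set _ e) (cong₂ _∨_ b₀e de)))))

remove-closer : ∀ {m} (B Z : Subset m) b N → lookup B b ≡ true → lookup Z b ≡ false →
  ∣ B ∖ Z ∣ ≤ suc N → ∣ remove B b ∖ Z ∣ ≤ N
remove-closer B Z b N bb zb le = ≤-pred (≤-trans (≤-reflexive (trans (cong suc (count-cong reorder))
  (sym (count-delete (λ e → lookup B e ∧ not (lookup Z e)) b (cong₂ (λ x y → x ∧ not y) bb zb))))) le)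
  where
  reorder : ∀ e → lookup (remove B b) e ∧ not (lookup Z e) ≡ (lookup B e ∧ not (lookup Z e)) ∧ not (δ b e)
  reorder e = trans (cong (_∧ not (lookup Z e)) (lookup-set _ e))
    (trans (∧-assoc (lookup B e) _ _)
      (trans (cong (lookup B e ∧_) (∧-comm (not (δ b e)) _))
        (sym (∧-assoc (lookup B e) _ _))))

-- Steinitz exchange: an independent set spanned by an independent B is no larger
-- than B.  Induction on |B ∖ Z|.
exchange : ∀ {r m} (A : Matrix r m) N (B Z : Subset m) → ∣ B ∖ Z ∣ ≤ N →
  Indep A B → Indep A Z → SpansAll A B Z → ∣ Z ∣ ≤ ∣ B ∣
exchange A N B Z le iB iZ spans with Fin.any? (λ e → (lookup B e ≟ᵇ true) ×-dec (lookup Z e ≟ᵇ false))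
... | no B⊆Z = ∣∣-mono Z B (spanned-independent⇒⊆ A B Z B⊆Z′ iZ spans)
  where
  B⊆Z′ : B ⊆ Z
  B⊆Z′ e be with lookup Z e in ze
  ... | true = refl
  ... | false = ⊥-elim (B⊆Z (e , be , ze))
exchange A zero B Z le iB iZ spans | yes (b , bb , zb) =
  ⊥-elim (1+n≰n (≤-trans (count-pos _ b (cong₂ (λ x y → x ∧ not y) bb zb)) le))
exchange A (suc N) B Z le iB iZ spans | yes (b , bb , zb) =
  decidable-stable (∣ Z ∣ ≤? ∣ B ∣) λ Z>B →
    Z>B (≤-trans (exchange A N B₀ Z (remove-closer B Z b N bb zb le) iB₀ iZ (B₀-spans Z>B))
                 (∣∣-mono B₀ B (remove-⊆ B b)))
  where
  B₀ = remove B b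
  iB₀ : Indep A B₀
  iB₀ = Indep-⊆ A B₀ B (remove-⊆ B b) iB
  -- if Z is larger than B, no swap is possible, so B₀ already spans Z
  B₀-spans : ¬ (∣ Z ∣ ≤ ∣ B ∣) → SpansAll A B₀ Z
  B₀-spans Z>B z zz y₀ o₀ with dot y₀ (col A z) in d₀
  ... | false = refl
  ... | true = ⊥-elim (Z>B (≤-trans
          (exchange A N B′ Z (≤-trans closer (remove-closer B Z b N bb zb le)) indep iZ spans′)
          (≤-reflexive size)))
    where open Swap (swap A B Z b z y₀ iB spans bb zz o₀ d₀) renaming (spans to spans′)

-- If X has rank below the whole matroid then (double-negatively) some functional
-- vanishes on X but not on some column: otherwise a basis of X would span a
-- basis of E, and the exchange lemma would bound rank A ⊤ by rank A X.
rank-deficit : ∀ {r m} (A : Matrix r m) X → rank A X < rank A ⊤ →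
  ¬ ¬ (Σ (Fin r → Bool) λ y → Vanishes A y X × Σ (Fin m) λ f → dot y (col A f) ≡ true)
rank-deficit A X lt noWitness =
  <⇒≱ lt (subst₂ _≤_ (Basis.size bE) (Basis.size bX)
    (exchange A _ (Basis.members bX) (Basis.members bE) ≤-refl (Basis.indep bX) (Basis.indep bE) spans))
  where
  bX = basisOf A X
  bE = basisOf A ⊤
  spans : SpansAll A (Basis.members bX) (Basis.members bE)
  spans f _ y o with dot y (col A f) in d
  ... | false = refl
  ... | true = ⊥-elim (noWitness (y , (λ x xx → basis-spans A X bX x xx y o) , f , d))

cocycle : ∀ {r m} → Matrix r m → (Fin r → Bool) → Fin m → Bool
cocycle A y e = dot y (col A e)

vanishes-off-cocycle : ∀ {r m} (A : Matrix r m) y → Vanishes A y (∁ (set (cocycle A y)))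
vanishes-off-cocycle A y x h = trans (sym (lookup-set (cocycle A y) x)) (∁-lookup (set (cocycle A y)) x h)

cocycle-cocircuit : ∀ {r m} (A : Matrix r m) y e₀ → cocycle A y e₀ ≡ true →
  (∀ e → lookup (set (cocycle A y)) e ≡ true → rank A (∁ (set (cocycle A y)) ∪ ⁅ e ⁆) ≡ rank A ⊤) →
  IsCocircuit A (set (cocycle A y))
cocycle-cocircuit A y e₀ d₀ full =
  ≤-antisym (≤-trans (≤-reflexive (+-comm (rank A (∁ Q)) 1)) (rank-gap A y (∁ Q) e₀ (vanishes-off-cocycle A y) d₀))
            (≤-trans (≤-reflexive (sym (full e₀ (trans (lookup-set _ e₀) d₀))))
              (≤-trans (rank-∪⁅⁆ A (∁ Q) e₀) (≤-reflexive (+-comm 1 (rank A (∁ Q))))))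
  , λ e e∉∁Q → full e (in-Q e e∉∁Q)
  where
  Q = set (cocycle A y)
  in-Q : ∀ e → ¬ (e ∈ ∁ Q) → lookup Q e ≡ true
  in-Q e e∉∁Q with lookup Q e in q
  ... | true = refl
  ... | false = ⊥-elim (e∉∁Q (lookup⇒[]= e (∁ Q) (trans (lookup-∁ Q e) (cong not q))))

-- Every cocircuit Q is a cocycle: a functional vanishing on E - Q but not everywhere
-- has cocycle exactly Q, since vanishing at some e ∈ Q would make it vanish on
-- (E - Q) ∪ {e}, which has full rank.
cocircuit-cocycle : ∀ {r m} (A : Matrix r m) Q y f → IsCocircuit A Q →
  Vanishes A y (∁ Q) → cocycle A y f ≡ true → ∀ e → cocycle A y e ≡ lookup Q e
cocircuit-cocycle A Q y f (_ , maximal) o d e with lookup Q e in qe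
... | false = o e (trans (lookup-∁ Q e) (cong not qe))
... | true with cocycle A y e in de
...   | true = refl
...   | false = ⊥-elim (1+n≰n (≤-trans (≤-reflexive (cong suc (sym (maximal e e∉∁Q))))
                  (rank-gap A y (∁ Q ∪ ⁅ e ⁆) f vanishes d)))
  where
  e∉∁Q : ¬ (e ∈ ∁ Q)
  e∉∁Q mem = true≢false (trans (sym ([]=⇒lookup mem)) (trans (lookup-∁ Q e) (cong not qe)))
  vanishes : Vanishes A y (∁ Q ∪ ⁅ e ⁆)
  vanishes x hx with δ e x in dx
  ... | true with δ-true e x dx
  ...   | refl = de
  vanishes x hx | false = o x (trans (sym (∨-identityʳ _))
    (trans (cong (lookup (∁ Q) x ∨_) (sym (trans (lookup-⁅⁆ e x) dx))) (trans (sym (lookup-∪ (∁ Q) ⁅ e ⁆ x)) hx)))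

cocycle-split : ∀ {r m} (A : Matrix r m) y y₂ → Vanishes A y₂ (∁ (set (cocycle A y))) → ∀ t →
  count (λ g → cocycle A y g ∧ t g) ≡
  count (λ g → cocycle A y₂ g ∧ t g) + count (λ g → cocycle A (λ i → y i xor y₂ i) g ∧ t g)
cocycle-split A y y₂ o₂ t =
  trans (count-nested (cocycle A y) (cocycle A y₂) t D₂⊆D)
    (cong (count (λ g → cocycle A y₂ g ∧ t g) +_) (count-cong (λ g → cong (_∧ t g) (sym (dot-xorˡ y y₂ (col A g))))))
  where
  D₂⊆D : ∀ g → cocycle A y₂ g ≡ true → cocycle A y g ≡ true
  D₂⊆D g hg with cocycle A y g in dg
  ... | true = refl
  ... | false = ⊥-elim (true≢false (trans (sym hg) (o₂ g (trans (lookup-∁ (set (cocycle A y)) g) (cong not (trans (lookup-set (cocycle A y) g) dg))))))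

cocycle-split-count : ∀ {r m} (A : Matrix r m) y y₂ → Vanishes A y₂ (∁ (set (cocycle A y))) →
  count (cocycle A y) ≡ count (cocycle A y₂) + count (cocycle A (λ i → y i xor y₂ i))
cocycle-split-count A y y₂ o₂ =
  trans (sym (count-∧true (cocycle A y))) (trans (cocycle-split A y y₂ o₂ (λ _ → true))
    (cong₂ _+_ (count-∧true (cocycle A y₂)) (count-∧true (cocycle A (λ i → y i xor y₂ i)))))

-- A nonempty set S that is not larger than its complement, whose complement is
-- contained in a hyperplane, is the first part of a |S|-separation; in an
-- n-connected matroid this forces |S| ≥ n.
hyperplane-complement-large : ∀ {r m} (A : Matrix r m) n S y f → NConnected A n →
  Vanishes A y (∁ S) → dot y (col A f) ≡ true → 1 ≤ ∣ S ∣ → ∣ S ∣ ≤ ∣ ∁ S ∣ → n ≤ ∣ S ∣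
hyperplane-complement-large A n S y f nc o d nonempty balanced =
  decidable-stable (n ≤? ∣ S ∣) λ small →
    nc ∣ S ∣ S nonempty (≰⇒> small)
      (≤-refl , balanced , connectivity≤pred (rank≤∣∣ A S) (rank-gap A y (∁ S) f o d))

∁-involutive : ∀ {m} (X : Subset m) → ∁ (∁ X) ≡ X
∁-involutive [] = refl
∁-involutive (x ∷ X) = cong₂ _∷_ (not-involutive x) (∁-involutive X)

separation-∁ : ∀ {r m} (A : Matrix r m) k X → IsSeparation A k X → IsSeparation A k (∁ X)
separation-∁ A k X (kX , k∁X , conn) rewrite sym (∁-involutive X) | ∁-involutive (∁ X) =
  k∁X , kX , subst (λ s → s ∸ rank A ⊤ ≤ k ∸ 1) (+-comm (rank A (∁ (∁ X))) (rank A (∁ X))) conn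

cocycle-large : ∀ {r m} (A : Matrix r m) p → NConnected A (suc (suc p)) → p + p + 2 ≤ m →
  ∀ y e → cocycle A y e ≡ true → suc (suc p) ≤ count (cocycle A y)
cocycle-large {m = m} A p nc pm y e h = decidable-stable (_ ≤? _) λ small →
  small (subst (suc (suc p) ≤_) ∣D∣
    (hyperplane-complement-large A (suc (suc p)) D y e nc (vanishes-off-cocycle A y) h
      (subst (1 ≤_) (sym ∣D∣) (count-pos (cocycle A y) e h)) (D≤∁D small)))
  where
  D = set (cocycle A y)
  ∣D∣ : ∣ D ∣ ≡ count (cocycle A y)
  ∣D∣ = ∣set∣ (cocycle A y)
  D≤∁D : ¬ (suc (suc p) ≤ count (cocycle A y)) → ∣ D ∣ ≤ ∣ ∁ D ∣
  D≤∁D small = subst₂ _≤_ (sym ∣D∣) (sym (trans (∣∁p∣≡n∸∣p∣ D) (cong (m ∸_) ∣D∣)))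
    (small≤complement (≤-pred (≰⇒> small)) pm)

CocircuitCondition : ∀ {r m} → Matrix r m → Subset m → Set
CocircuitCondition {m = m} A T =
  ∀ (Q : Subset m) → IsCocircuit A Q → Nonempty (Q ∩ T) → ∣ Q ∣ ≥ 2 * ∣ Q ∩ T ∣

cocycleT : ∀ {r m} → Matrix r m → Subset m → (Fin r → Bool) → Fin m → Bool
cocycleT A T y e = cocycle A y e ∧ lookup T e

cocircuit-balanced : ∀ {r m} (A : Matrix r m) T y e₀ → CocircuitCondition A T →
  IsCocircuit A (set (cocycle A y)) → cocycleT A T y e₀ ≡ true →
  2 * count (cocycleT A T y) ≤ count (cocycle A y)
cocircuit-balanced A T y e₀ cond cocircuit e₀∈DT =
  subst₂ (λ a b → 2 * a ≤ b) ∣Q∩T∣ (∣set∣ (cocycle A y)) (cond Q cocircuit (e₀ , e₀∈Q∩T))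
  where
  Q = set (cocycle A y)
  lookup-Q∩T : ∀ e → lookup (Q ∩ T) e ≡ cocycleT A T y e
  lookup-Q∩T e = trans (lookup-∩ Q T e) (cong (_∧ lookup T e) (lookup-set _ e))
  ∣Q∩T∣ : ∣ Q ∩ T ∣ ≡ count (cocycleT A T y)
  ∣Q∩T∣ = trans (∣∣≡count (Q ∩ T)) (count-cong lookup-Q∩T)
  e₀∈Q∩T : e₀ ∈ Q ∩ T
  e₀∈Q∩T = lookup⇒[]= e₀ (Q ∩ T) (trans (lookup-Q∩T e₀) e₀∈DT)

-- Induction on |D|: if D is not a cocircuit, some e ∈ D leaves (E - D) ∪ {e} of
-- deficient rank, and a functional y₂ witnessing this splits D into the two
-- smaller nonempty cocycles of y₂ and y ⊕ y₂.
cocycle-balanced : ∀ {r m} (A : Matrix r m) T → CocircuitCondition A T →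
  ∀ N y → count (cocycle A y) ≤ N → 2 * count (cocycleT A T y) ≤ count (cocycle A y)
cocycle-balanced A T cond zero y le =
  ≤-trans (*-monoʳ-≤ 2 (≤-trans (count-mono {f = cocycleT A T y} {g = cocycle A y} (λ e h → ∧-conicalˡ _ _ h)) le)) z≤n
cocycle-balanced A T cond (suc N) y le = decidable-stable (_ ≤? _) λ unbalanced →
  let e₀ , e₀∈DT = count-witness (cocycleT A T y) (positive unbalanced) in
  unbalanced (cocircuit-balanced A T y e₀ cond
    (cocycle-cocircuit A y e₀ (∧-conicalˡ _ _ e₀∈DT) (full-rank unbalanced)) e₀∈DT)
  where
  D = set (cocycle A y)
  positive : ¬ (2 * count (cocycleT A T y) ≤ count (cocycle A y)) → 1 ≤ count (cocycleT A T y)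
  positive unbalanced with count (cocycleT A T y)
  ... | zero = ⊥-elim (unbalanced z≤n)
  ... | suc _ = s≤s z≤n
  split : ∀ y₂ e f → cocycle A y e ≡ true → Vanishes A y₂ (∁ D ∪ ⁅ e ⁆) → cocycle A y₂ f ≡ true →
    2 * count (cocycleT A T y) ≤ count (cocycle A y)
  split y₂ e f de o₂ d₂ =
    balance-+ {c₂ = count (cocycleT A T y₂)} {count (cocycleT A T y₃)}
      (cocycle-split A y y₂ off-D (lookup T)) count-D
      (cocycle-balanced A T cond N y₂ (summand≤pred count-D (count-pos _ e d₃e) le))
      (cocycle-balanced A T cond N y₃
        (summand≤pred (trans count-D (+-comm (count (cocycle A y₂)) _)) (count-pos _ f d₂) le))
    where
    y₃ = λ i → y i xor y₂ i
    off-D : Vanishes A y₂ (∁ D)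
    off-D g h = o₂ g (trans (lookup-∪ (∁ D) ⁅ e ⁆ g) (cong (_∨ lookup ⁅ e ⁆ g) h))
    count-D : count (cocycle A y) ≡ count (cocycle A y₂) + count (cocycle A y₃)
    count-D = cocycle-split-count A y y₂ off-D
    d₃e : cocycle A y₃ e ≡ true
    d₃e = trans (dot-xorˡ y y₂ (col A e))
      (cong₂ _xor_ de (o₂ e (trans (lookup-∪ (∁ D) ⁅ e ⁆ e)
        (trans (cong (lookup (∁ D) e ∨_) (trans (lookup-⁅⁆ e e) (δ-refl e))) (∨-zeroʳ _)))))
  full-rank : ¬ (2 * count (cocycleT A T y) ≤ count (cocycle A y)) →
    ∀ e → lookup D e ≡ true → rank A (∁ D ∪ ⁅ e ⁆) ≡ rank A ⊤
  full-rank unbalanced e e∈D = decidable-stable (rank A (∁ D ∪ ⁅ e ⁆) ≟ rank A ⊤) λ deficient →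
    rank-deficit A (∁ D ∪ ⁅ e ⁆) (≤∧≢⇒< (rank-mono A (∁ D ∪ ⁅ e ⁆) ⊤ (⊆-⊤ (∁ D ∪ ⁅ e ⁆))) deficient)
      λ (y₂ , o₂ , f , d₂) → unbalanced (split y₂ e f (trans (sym (lookup-set _ e)) e∈D) o₂ d₂)

∷-⊆ : ∀ {m} b {B X : Subset m} → B ⊆ X → (b ∷ B) ⊆ (b ∷ X)
∷-⊆ b B⊆X zero h = h
∷-⊆ b B⊆X (suc e) h = B⊆X e h

module Splitting {r m : ℕ} (A : Matrix r m) (T : Subset m) where

  A′ : Matrix (suc r) (suc m)
  A′ = splitMatrix A T

  -- A functional on A′ takes its first coordinate at the new element a; at an old
  -- element e it takes (y zero ∧ [e ∈ T]) ⊕ cocycle A (tail y) e, definitionally.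
  dot-a : ∀ (y : Fin (suc r) → Bool) → dot y (col A′ zero) ≡ y zero
  dot-a y = trans (cong₂ _xor_ (∧-identityʳ (y zero)) (dot-zeroʳ (tail y))) (xor-identityʳ (y zero))

  indep-old : ∀ I → Indep A I → Indep A′ (false ∷ I)
  indep-old I ind (true ∷ Z) s ne z = true≢false (sym (s zero refl))
  indep-old I ind (false ∷ Z) s (zero , ()) z
  indep-old I ind (false ∷ Z) s (suc e , p) z = ind Z (λ e h → s (suc e) h) (e , p) (λ i → z (suc i))

  -- A dependency among {a} ∪ I gives one of I in the old rows, so it is {a} alone,
  -- whose column is nonzero.
  indep-with-a : ∀ I → Indep A I → Indep A′ (true ∷ I)
  indep-with-a I ind (z₀ ∷ Z) s nonempty zero-sum = true≢false (trans (sym row0) (zero-sum zero))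
    where
    Z-sum : Zero A Z
    Z-sum i = trans (sym (cong (_xor colSum A Z i) (∧-zeroʳ z₀))) (zero-sum (suc i))
    Z-empty : ∀ e → lookup Z e ≡ false
    Z-empty e with lookup Z e in ze
    ... | false = refl
    ... | true = ⊥-elim (ind Z (λ e h → s (suc e) h) (e , ze) Z-sum)
    a-used : Inhabited (z₀ ∷ Z) → z₀ ≡ true
    a-used (zero , p) = p
    a-used (suc e , p) = ⊥-elim (true≢false (trans (sym p) (Z-empty e)))
    row0 : colSum A′ (z₀ ∷ Z) zero ≡ true
    row0 rewrite a-used nonempty = cong (true xor_) (sumOver-vanishing Z (lookup T) (λ e h → ⊥-elim (true≢false (trans (sym h) (Z-empty e)))))

  rank-old : ∀ X → rank A X ≤ rank A′ (false ∷ X)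
  rank-old X = let basis B bs bi bz = basisOf A X in
    subst (_≤ rank A′ (false ∷ X)) bz (rank-≥ A′ (false ∷ X) (false ∷ B) (∷-⊆ false bs) (indep-old B bi))

  rank-with-a : ∀ X → suc (rank A X) ≤ rank A′ (true ∷ X)
  rank-with-a X = let basis B bs bi bz = basisOf A X in
    subst (λ k → suc k ≤ rank A′ (true ∷ X)) bz (rank-≥ A′ (true ∷ X) (true ∷ B) (∷-⊆ true bs) (indep-with-a B bi))

  -- a together with a basis of M spans M′_T, so r(M′_T) ≤ r(M) + 1.
  rank-total : rank A′ ⊤ ≤ suc (rank A ⊤)
  rank-total = subst₂ _≤_ (Basis.size bE′) (cong suc (Basis.size bE))
    (exchange A′ _ (true ∷ B) (Basis.members bE′) ≤-refl (indep-with-a B (Basis.indep bE)) (Basis.indep bE′) spans)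
    where
    bE = basisOf A ⊤
    bE′ = basisOf A′ ⊤
    B = Basis.members bE
    spans : SpansAll A′ (true ∷ B) (Basis.members bE′)
    spans f _ y o = vanishes f
      where
      y₀ : y zero ≡ false
      y₀ = trans (sym (dot-a y)) (o zero refl)
      old : ∀ e → dot y (col A′ (suc e)) ≡ cocycle A (tail y) e
      old e = cong (λ c → (c ∧ lookup T e) xor cocycle A (tail y) e) y₀
      vanishes : ∀ f → dot y (col A′ f) ≡ false
      vanishes zero = trans (dot-a y) y₀
      vanishes (suc e) = trans (old e)
        (basis-spans A ⊤ bE e (lookup-⊤ e) (tail y) (λ e be → trans (sym (old e)) (o (suc e) be)))

  oldPart : (Fin (suc r) → Bool) → Fin m → Bool
  oldPart y e = (y zero ∧ lookup T e) xor cocycle A (tail y) e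

  oldPart-⊆ : ∀ y Y → Vanishes A′ y (false ∷ ∁ Y) → count (oldPart y) ≤ ∣ Y ∣
  oldPart-⊆ y Y o = ≤-trans (count-mono inY) (≤-reflexive (sym (∣∣≡count Y)))
    where
    inY : ∀ e → oldPart y e ≡ true → lookup Y e ≡ true
    inY e h with lookup Y e in ye
    ... | true = refl
    ... | false = ⊥-elim (true≢false (trans (sym h) (o (suc e) (trans (lookup-∁ Y e) (cong not ye)))))

  Δ-count : ∀ p → ∣ T ∣ ≡ suc p → ∀ (D : Fin m → Bool) →
    count (λ e → D e xor lookup T e) + 2 * count (λ e → D e ∧ lookup T e) ≡ count D + suc p
  Δ-count p |T| D = trans (count-xor D (lookup T)) (cong (count D +_) (trans (sym (∣∣≡count T)) |T|))

  -- (⇒) A cocircuit Q with 2|Q ∩ T| > |Q| is the cocycle of some y; then (1, y)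
  -- vanishes off S = {a} ∪ (Q Δ T) but not at a, and |Q Δ T| ≤ p, so S would be a
  -- small separation of M′_T.
  condition-from-split : ∀ p → NConnected A′ (suc (suc p)) → p + p + 2 ≤ m → ∣ T ∣ ≡ suc p →
    CocircuitCondition A T
  condition-from-split p nc′ pm |T| Q cocircuit _ = decidable-stable (2 * ∣ Q ∩ T ∣ ≤? ∣ Q ∣) λ unbalanced →
    rank-deficit A (∁ Q) (≤-reflexive (trans (+-comm 1 _) (proj₁ cocircuit))) λ (y , o , f , d) →
      small-separation unbalanced y o f d
    where
    QΔT : Fin m → Bool
    QΔT e = lookup Q e xor lookup T e
    Y = set QΔT
    small-separation : ¬ (2 * ∣ Q ∩ T ∣ ≤ ∣ Q ∣) → ∀ y → Vanishes A y (∁ Q) → ∀ f → cocycle A y f ≡ true → ⊥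
    small-separation unbalanced y o f d = 1+n≰n (≤-trans (≤-pred large) (subst (_≤ p) (sym (∣set∣ QΔT)) |Y|≤p))
      where
      D≡Q : ∀ e → cocycle A y e ≡ lookup Q e
      D≡Q = cocircuit-cocycle A Q y f cocircuit o d
      |Y|≤p : count QΔT ≤ p
      |Y|≤p = Equivalence.from (small-Δ⇔unbalanced {c = count (λ e → lookup Q e ∧ lookup T e)} (Δ-count p |T| (lookup Q)))
        (subst₂ (λ a b → a < 2 * b) (∣∣≡count Q) (trans (∣∣≡count (Q ∩ T)) (count-cong (lookup-∩ Q T))) (≰⇒> unbalanced))
      vanishes : Vanishes A′ (true ∷ᶠ y) (∁ (true ∷ Y))
      vanishes zero ()
      vanishes (suc e) h = trans (cong (lookup T e xor_) (D≡Q e))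
        (trans (xor-comm (lookup T e) (lookup Q e)) (trans (sym (lookup-set QΔT e)) (∁-lookup Y e h)))
      large : suc (suc p) ≤ suc ∣ Y ∣
      large = hyperplane-complement-large A′ (suc (suc p)) (true ∷ Y) (true ∷ᶠ y) zero nc′ vanishes
        (dot-a (true ∷ᶠ y)) (s≤s z≤n)
        (≤-trans (small≤complement (s≤s (subst (_≤ p) (sym (∣set∣ QΔT)) |Y|≤p)) pm)
          (≤-trans (∸-monoʳ-≤ m (n≤1+n ∣ Y ∣)) (≤-reflexive (sym (∣∁p∣≡n∸∣p∣ Y)))))

  -- (⇐) Under the cocircuit condition M′_T has no k-separation (S, E′ - S) with
  -- k ≤ p + 1 and a ∈ S.  Write S = {a} ∪ Y.  As r′({a} ∪ Y) ≥ r(Y) + 1,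
  -- r′(E′ - S) ≥ r(E - Y) and r′(E′) ≤ r(E) + 1, (Y, E - Y) would be a k-separation
  -- of M unless k = |Y| + 1, and a |Y|-separation unless Y is independent; then
  -- r′({a} ∪ Y) ≥ k, so E′ - S is rank-deficient in M′_T,
  -- and the functional y witnessing this has its old part inside Y, so |Y| ≤ p
  -- contradicts either the size of nonempty cocycles (y zero = 0) or their
  -- balance (y zero = 1).
  no-separation-with-a : ∀ p → NConnected A (suc (suc p)) → p + p + 2 ≤ m → ∣ T ∣ ≡ suc p →
    CocircuitCondition A T → ∀ k Y → 1 ≤ k → k < suc (suc p) → ¬ IsSeparation A′ k (true ∷ Y)
  no-separation-with-a p nc pm |T| cond k Y 1≤k k<n (k≤|S| , k≤|∁Y| , conn′) =
    rank-deficit A′ (false ∷ ∁ Y) gap λ (y , o , f , d) → no-functional y o f d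
    where
    conn : rank A Y + rank A (∁ Y) ∸ rank A ⊤ ≤ k ∸ 1
    conn = ≤-trans (∸-mono (+-mono-≤ (rank-with-a Y) (rank-old (∁ Y))) rank-total) conn′
    |Y|<k : ∣ Y ∣ < k
    |Y|<k = ≰⇒> λ k≤|Y| → nc k Y 1≤k k<n (k≤|Y| , k≤|∁Y| , conn)
    |Y|≤p : ∣ Y ∣ ≤ p
    |Y|≤p = ≤-pred (≤-trans |Y|<k (≤-pred k<n))
    independent : ∣ Y ∣ ≤ rank A Y
    independent = decidable-stable (_ ≤? _) λ dependent →
      nc ∣ Y ∣ Y (≤-trans (s≤s z≤n) (≰⇒> dependent)) (s≤s (≤-trans |Y|≤p (n≤1+n p)))
        ( ≤-refl , ≤-trans (n≤1+n _) (≤-trans |Y|<k k≤|∁Y|)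
        , connectivity≤pred′ (≰⇒> dependent) (rank-mono A (∁ Y) ⊤ (⊆-⊤ (∁ Y))))
    gap : rank A′ (false ∷ ∁ Y) < rank A′ ⊤
    gap = connectivity-gap (≤-trans k≤|S| (≤-trans (s≤s independent) (rank-with-a Y))) 1≤k conn′
    no-functional : ∀ y → Vanishes A′ y (false ∷ ∁ Y) → ∀ f → dot y (col A′ f) ≡ true → ⊥
    no-functional y o f d with y zero ≟ᵇ true
    ... | yes y₀ = <⇒≱ unbalanced (cocycle-balanced A T cond _ (tail y) ≤-refl)
      where
      ΔT≤p : count (λ e → cocycle A (tail y) e xor lookup T e) ≤ p
      ΔT≤p = ≤-trans (≤-reflexive (count-cong λ e → trans (xor-comm _ (lookup T e))
                 (cong (λ c → (c ∧ lookup T e) xor cocycle A (tail y) e) (sym y₀))))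
               (≤-trans (oldPart-⊆ y Y o) |Y|≤p)
      unbalanced : count (cocycle A (tail y)) < 2 * count (cocycleT A T (tail y))
      unbalanced = Equivalence.to
        (small-Δ⇔unbalanced {c = count (cocycleT A T (tail y))} (Δ-count p |T| (cocycle A (tail y)))) ΔT≤p
    ... | no y₀ = a-outside f d
      where
      old≡D : ∀ e → oldPart y e ≡ cocycle A (tail y) e
      old≡D e = cong (λ c → (c ∧ lookup T e) xor cocycle A (tail y) e) (¬-not y₀)
      a-outside : ∀ f → dot y (col A′ f) ≡ true → ⊥
      a-outside zero d = y₀ (trans (sym (dot-a y)) d)
      a-outside (suc e) d = 1+n≰n (≤-trans (≤-trans
        (cocycle-large A p nc pm (tail y) e (trans (sym (old≡D e)) d))
        (≤-trans (≤-reflexive (sym (count-cong old≡D))) (oldPart-⊆ y Y o))) (≤-trans |Y|≤p (n≤1+n p)))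

  -- (⇐) Every separation of M′_T has a on one side.
  split-connected : ∀ p → NConnected A (suc (suc p)) → p + p + 2 ≤ m → ∣ T ∣ ≡ suc p →
    CocircuitCondition A T → NConnected A′ (suc (suc p))
  split-connected p nc pm |T| cond k (true ∷ Y) 1≤k k<n sep =
    no-separation-with-a p nc pm |T| cond k Y 1≤k k<n sep
  split-connected p nc pm |T| cond k (false ∷ X) 1≤k k<n sep =
    no-separation-with-a p nc pm |T| cond k (∁ X) 1≤k k<n (separation-∁ A′ k (false ∷ X) sep)

mainTheorem1 : (n r m : ℕ) (A : Matrix r m) (T : Subset m) →
    n ≥ 2 → NConnected A n → m ≥ 2 * n ∸ 2 → ∣ T ∣ ≡ n ∸ 1 →
    (NConnected (splitMatrix A T) n ⇔
      (∀ (Q : Subset m) → IsCocircuit A Q → Nonempty (Q ∩ T) → ∣ Q ∣ ≥ 2 * ∣ Q ∩ T ∣))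
mainTheorem1 (suc (suc p)) r m A T _ nc m≥2n-2 |T| =
  mk⇔ (λ nc′ → condition-from-split p nc′ p+p+2≤m |T|) (split-connected p nc p+p+2≤m |T|)
  where
  open Splitting A T
  p+p+2≤m : p + p + 2 ≤ m
  p+p+2≤m = ≤-trans (≤-reflexive (2n-2 p)) m≥2n-2
    where
    2n-2 : ∀ p → p + p + 2 ≡ p + (2 + (p + 0))
    2n-2 = solve 1 (λ p → p :+ p :+ con 2 := p :+ (con 2 :+ (p :+ con 0))) refl
      where open +-*-Solver
mainTheorem1 (suc zero) r m A T (s≤s ()) nc m≥2n-2 |T|
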